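{- Let $p$ and $r$ be coupled cubic Galois polynomials. Then the map sending $\lambda\,p(\alpha x+\beta)$ to $\lambda\,r(\alpha x+\beta)$ (for $\lambda,\alpha,\beta\in\mathbb{Q}$, $\lambda\alpha\neq0$) is a bijection between the class $C(p)$ and the class $C(r)$, and it sends each polynomial of $C(p)$ to a polynomial coupled with it.
   Context: A cubic Galois polynomial is an irreducible cubic polynomial with rational coefficients whose Galois group over $\mathbb{Q}$ is the cyclic group $A_3$. A quadratic polynomial $q\in\mathbb{Q}[x]$ cyclically permutes the roots of a cubic polynomial if its roots can be enumerated $x_1,x_2,x_3$ so that $q(x_1)=x_2$, $q(x_2)=x_3$, $q(x_3)=x_1$. Two cubic Galois polynomials are coupled if there exists a quadratic polynomial $q\in\mathbb{Q}[x]$ that cyclically permutes the roots of both. Two polynomials are linearly equivalent if one is obtained from the other by a linear change of variable $x\mapsto \alpha x+\beta$ ($\alpha,\beta\in\mathbb{Q}$, $\alpha\ne0$); polynomials are considered up to a nonzero rational constant factor (so that, e.g., each class contains a monic polynomial). $C(p)$ denotes the class of polynomials linearly equivalent to $p$. -}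

module Defs where

open import Level using (0ℓ)
open import Data.Rational using (ℚ; 0ℚ; 1ℚ) renaming (_+_ to _+ℚ_; _*_ to _*ℚ_)
open import Data.Fin using (Fin) renaming (zero to fz; suc to fs)
open import Data.Fin.Permutation using (Permutation′; _⟨$⟩ʳ_)
open import Data.Product using (Σ; ∃; _×_; _,_)
open import Data.Sum using (_⊎_)
open import Relation.Nullary using (¬_)
open import Relation.Binary.PropositionalEquality using (_≡_)
open import Algebra.Bundles using (CommutativeRing)

record Poly3 : Set where
  constructor poly3
  field
    c3 c2 c1 c0 : ℚ
open Poly3 public

record Poly2 : Set where
  constructor poly2
  field
    b2 b1 b0 : ℚ
open Poly2 public

IsCubic : Poly3 → Set
IsCubic p = ¬ (c3 p ≡ 0ℚ)

IsQuadratic : Poly2 → Set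
IsQuadratic q = ¬ (b2 q ≡ 0ℚ)

-- λ · p(αx + β), coefficients written out
transform : ℚ → ℚ → ℚ → Poly3 → Poly3
transform λ' α β (poly3 a b c d) = poly3
  (λ' *ℚ (a *ℚ (α *ℚ α *ℚ α)))
  (λ' *ℚ ((1ℚ +ℚ 1ℚ +ℚ 1ℚ) *ℚ a *ℚ (α *ℚ α) *ℚ β +ℚ b *ℚ (α *ℚ α)))
  (λ' *ℚ ((1ℚ +ℚ 1ℚ +ℚ 1ℚ) *ℚ a *ℚ α *ℚ (β *ℚ β) +ℚ (1ℚ +ℚ 1ℚ) *ℚ b *ℚ α *ℚ β +ℚ c *ℚ α))
  (λ' *ℚ (a *ℚ (β *ℚ β *ℚ β) +ℚ b *ℚ (β *ℚ β) +ℚ c *ℚ β +ℚ d))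

-- A cubic can only factor into non-units (= nonconstant
-- polynomials) of degrees 1 and 2, so reducibility means
-- p = (u₁x +ℚ u₀)(v₂x² +ℚ v₁x +ℚ v₀) with u₁ ≠ 0 (then v₂ ≠ 0 automatically).
Irreducible : Poly3 → Set
Irreducible p = ¬ (Σ ℚ λ u1 → Σ ℚ λ u0 → Σ ℚ λ v2 → Σ ℚ λ v1 → Σ ℚ λ v0 →
  ¬ (u1 ≡ 0ℚ) ×
  c3 p ≡ u1 *ℚ v2 ×
  c2 p ≡ u1 *ℚ v1 +ℚ u0 *ℚ v2 ×
  c1 p ≡ u1 *ℚ v0 +ℚ u0 *ℚ v1 ×
  c0 p ≡ u0 *ℚ v0)

i0 i1 i2 : Fin 3
i0 = fz
i1 = fs fz
i2 = fs (fs fz)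

record ExtField : Set₁ where
  field
    commRing : CommutativeRing 0ℓ 0ℓ
  open CommutativeRing commRing public
  field
    nontrivial : ¬ (1# ≈ 0#)
    inverse    : ∀ x → ¬ (x ≈ 0#) → ∃ λ y → x * y ≈ 1#
    ι      : ℚ → Carrier
    ι-+    : ∀ a b → ι (a +ℚ b) ≈ ι a + ι b
    ι-*    : ∀ a b → ι (a *ℚ b) ≈ ι a * ι b
    ι-1    : ι 1ℚ ≈ 1#

module _ (K : ExtField) where
  open ExtField K

  evalQ : Poly2 → Carrier → Carrier
  evalQ q x = ι (b2 q) * (x * x) + ι (b1 q) * x + ι (b0 q)

  -- x₁, x₂, x₃ is an enumeration of the roots of p in K (with multiplicity):
  -- p(X) = a₃ (X - x₁)(X - x₂)(X - x₃) in K[X], coefficientwise.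
  RootsIn : Poly3 → (Fin 3 → Carrier) → Set
  RootsIn p x =
    ι (c2 p) ≈ - (ι (c3 p) * (x i0 + x (i1) + x (i2))) ×
    ι (c1 p) ≈ ι (c3 p) * (x i0 * x (i1) + x i0 * x (i2)
                           + x (i1) * x (i2)) ×
    ι (c0 p) ≈ - (ι (c3 p) * (x i0 * x (i1) * x (i2)))

-- Galois group, defined (as Galois did) as the group of permutations of the
-- roots that preserve every polynomial relation with rational coefficients.

data MPoly : Set where
  con  : ℚ → MPoly
  var  : Fin 3 → MPoly
  _⊕_  : MPoly → MPoly → MPoly
  _⊗_  : MPoly → MPoly → MPoly

module _ (K : ExtField) where
  open ExtField K

  evalM : (Fin 3 → Carrier) → MPoly → Carrier
  evalM x (con a)  = ι a
  evalM x (var i)  = x i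
  evalM x (F ⊕ G)  = evalM x F + evalM x G
  evalM x (F ⊗ G)  = evalM x F * evalM x G

  InGal : (Fin 3 → Carrier) → Permutation′ 3 → Set
  InGal x σ = ∀ F → evalM x F ≈ 0# → evalM (λ i → x (σ ⟨$⟩ʳ i)) F ≈ 0#

cyc : Fin 3 → Fin 3
cyc fz = i1
cyc (fs fz) = i2
cyc (fs (fs fz)) = i0

InA3 : Permutation′ 3 → Set
InA3 σ = (∀ i → σ ⟨$⟩ʳ i ≡ i) ⊎ (∀ i → σ ⟨$⟩ʳ i ≡ cyc i) ⊎ (∀ i → σ ⟨$⟩ʳ i ≡ cyc (cyc i))

-- Galois group of p over ℚ is A₃ (computed from the roots in some field
-- containing them; the answer does not depend on the choice, up to relabeling,
-- and A₃ is normal in S₃)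
GalIsA3 : Poly3 → Set₁
GalIsA3 p = Σ ExtField λ K → Σ (Fin 3 → ExtField.Carrier K) λ x →
  RootsIn K p x × (∀ σ → (InGal K x σ → InA3 σ) × (InA3 σ → InGal K x σ))

CubicGalois : Poly3 → Set₁
CubicGalois p = IsCubic p × Irreducible p × GalIsA3 p

CyclPerm : Poly2 → Poly3 → Set₁
CyclPerm q p = Σ ExtField λ K → Σ (Fin 3 → ExtField.Carrier K) λ x →
  let open ExtField K in
  RootsIn K p x ×
  evalQ K q (x i0) ≈ x (i1) ×
  evalQ K q (x (i1)) ≈ x (i2) ×
  evalQ K q (x (i2)) ≈ x i0

Coupled : Poly3 → Poly3 → Set₁
Coupled p r = CubicGalois p × CubicGalois r ×
  Σ Poly2 λ q → IsQuadratic q × CyclPerm q p × CyclPerm q r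

-- Write p_{L,α,β}(x) = L·p(αx + β). An irreducible cubic p = ax³ + bx² + cx + d determines the
-- parameters of p_{L,α,β}: the leading coefficient of p_{L,α,β} is a·Lα³, and the quantity
-- 27a²d − 9abc + 2b³ = 27a²·p(−b/3a), which is nonzero because p has no rational root, gets
-- multiplied by L³α⁶ = (Lα³)²·L. This fixes L, then α (cube roots are unique in ℚ), then β.
-- So λp(αx+β) ↦ λr(αx+β) is well defined, and injective by symmetry. For the coupling, if q
-- cyclically permutes the roots xᵢ of p, then yᵢ = (xᵢ − β)/α are the roots of p_{L,α,β}, they
-- are cyclically permuted by the conjugate quadratic (q(αy + β) − β)/α, and the Galois group
-- does not change because xᵢ ↦ yᵢ is an invertible affine map with rational coefficients.
module Submission where

open import Defs
open import Data.Rational using (ℚ; 0ℚ)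
open import Data.Product using (Σ; _×_)
open import Relation.Nullary using (¬_)
open import Relation.Binary.PropositionalEquality using (_≡_)

module RationalCubics where

  open import Level using (0ℓ)
  open import Agda.Builtin.FromNat using (Number; fromNat)
  open import Algebra.Bundles using (CommutativeMonoid)
  open import Data.Fin using (Fin; zero; suc)
  open import Data.Nat using (ℕ)
  open import Data.Product using (_,_; proj₁; proj₂)
  open import Data.Unit using (tt)
  open import Relation.Nullary using (yes; no; contradiction)
  open import Relation.Nullary.Decidable using (dec⇒maybe)
  open import Relation.Binary.Definitions using (tri<; tri≈; tri>)
  open import Relation.Binary.PropositionalEquality
    using (_≢_; refl; sym; trans; cong; cong₂; subst₂; module ≡-Reasoning)
  open import Tactic.RingSolver using (solve-∀)
  open import Tactic.RingSolver.Core.AlmostCommutativeRing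
    using (AlmostCommutativeRing; fromCommutativeRing)
  open import Data.Rational
    using (1ℚ; _+_; _*_; -_; _-_; 1/_; ≢-nonZero; Positive; NonNegative; positive; negative)
  open import Data.Rational.Properties
    using ( _≟_; <-cmp; <-irrefl; positive⁻¹; pos⇒nonNeg; pos*pos⇒pos; neg*neg⇒pos; nonNeg+pos⇒pos
          ; +-*-commutativeRing; +-0-group; *-1-commutativeMonoid; heytingCommutativeRing
          ; +-identityˡ; +-inverseʳ; *-identityˡ; *-inverseˡ; *-inverseʳ; *-assoc; *-zeroˡ; *-zeroʳ )
  open import Algebra.Apartness.Properties.HeytingCommutativeRing heytingCommutativeRing
    using (x#0y#0→xy#0)
  open import Algebra.Properties.CommutativeSemigroup
    (CommutativeMonoid.commutativeSemigroup *-1-commutativeMonoid) using (x∙yz≈y∙xz)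
  open import Algebra.Properties.Group +-0-group using (∙-cancelʳ; x∙y⁻¹≈ε⇒x≈y)
  import Data.Nat.Literals as ℕ
  import Data.Rational.Literals as ℚ

  instance
    ℕ-number : Number ℕ
    ℕ-number = ℕ.number
    ℚ-number : Number ℚ
    ℚ-number = ℚ.number

  ℚ-ring : AlmostCommutativeRing 0ℓ 0ℓ
  ℚ-ring = fromCommutativeRing +-*-commutativeRing (λ x → dec⇒maybe (0ℚ ≟ x))

  *-cancelˡ-≢0 : ∀ {x y z} → x ≢ 0ℚ → x * y ≡ x * z → y ≡ z
  *-cancelˡ-≢0 {x} {y} {z} x≢0 xy≡xz =
    trans (sym (1/x*[x*u]≡u y)) (trans (cong (1/ x *_) xy≡xz) (1/x*[x*u]≡u z))
    where
    instance _ = ≢-nonZero x≢0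
    1/x*[x*u]≡u : ∀ u → 1/ x * (x * u) ≡ u
    1/x*[x*u]≡u u = trans (sym (*-assoc (1/ x) x u)) (trans (cong (_* u) (*-inverseˡ x)) (*-identityˡ u))

  x*y≡0⇒y≡0 : ∀ {x y} → x ≢ 0ℚ → x * y ≡ 0ℚ → y ≡ 0ℚ
  x*y≡0⇒y≡0 {x} x≢0 xy≡0 = *-cancelˡ-≢0 x≢0 (trans xy≡0 (sym (*-zeroʳ x)))

  cube≢0 : ∀ {x} → x ≢ 0ℚ → x * x * x ≢ 0ℚ
  cube≢0 x≢0 = x#0y#0→xy#0 (x#0y#0→xy#0 x≢0 x≢0) x≢0

  pos⇒≢0 : ∀ {x} → Positive x → x ≢ 0ℚ
  pos⇒≢0 x>0 refl = <-irrefl refl (positive⁻¹ 0ℚ {{x>0}})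

  square-pos : ∀ {x} → x ≢ 0ℚ → Positive (x * x)
  square-pos {x} x≢0 with <-cmp x 0ℚ
  ... | tri< x<0 _ _ = neg*neg⇒pos x {{negative x<0}} x {{negative x<0}}
  ... | tri≈ _ x≡0 _ = contradiction x≡0 x≢0
  ... | tri> _ _ x>0 = pos*pos⇒pos x {{positive x>0}} x {{positive x>0}}

  square-nonNeg : ∀ x → NonNegative (x * x)
  square-nonNeg x with x ≟ 0ℚ
  ... | yes refl = _
  ... | no x≢0   = pos⇒nonNeg (x * x) {{square-pos x≢0}}

  cube-injective : ∀ {x y} → x * x * x ≡ y * y * y → x ≡ y
  cube-injective {x} {y} x³≡y³ with x ≟ y
  ... | yes x≡y = x≡y
  ... | no x≢y with y ≟ 0ℚ
  ...   | yes refl = contradiction x³≡y³ (cube≢0 x≢y)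
  ...   | no y≢0   = contradiction (x*y≡0⇒y≡0 x-y≢0 [x-y]*S≡0) (pos⇒≢0 S>0)
    where
    open ≡-Reasoning
    S : ℚ
    S = (2 * x + y) * (2 * x + y) + 3 * (y * y)
    S>0 : Positive S
    S>0 = nonNeg+pos⇒pos ((2 * x + y) * (2 * x + y)) {{square-nonNeg (2 * x + y)}}
                          (3 * (y * y)) {{pos*pos⇒pos 3 (y * y) {{square-pos y≢0}}}}
    x-y≢0 : x - y ≢ 0ℚ
    x-y≢0 x-y≡0 = x≢y (x∙y⁻¹≈ε⇒x≈y x y x-y≡0)
    factorisation : ∀ x y →
      (x - y) * ((2 * x + y) * (2 * x + y) + 3 * (y * y)) ≡ 4 * (x * x * x - y * y * y)
    factorisation = solve-∀ ℚ-ring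
    [x-y]*S≡0 : (x - y) * S ≡ 0ℚ
    [x-y]*S≡0 = begin
      (x - y) * S                 ≡⟨ factorisation x y ⟩
      4 * (x * x * x - y * y * y) ≡⟨ cong (λ t → 4 * (t - y * y * y)) x³≡y³ ⟩
      4 * (y * y * y - y * y * y) ≡⟨ cong (4 *_) (+-inverseʳ (y * y * y)) ⟩
      0ℚ                          ∎

  eval : Poly3 → ℚ → ℚ
  eval (poly3 a b c d) t = a * (t * t * t) + b * (t * t) + c * t + d

  Reducible : Poly3 → Set
  Reducible p = Σ ℚ λ u1 → Σ ℚ λ u0 → Σ ℚ λ v2 → Σ ℚ λ v1 → Σ ℚ λ v0 →
    u1 ≢ 0ℚ ×
    c3 p ≡ u1 * v2 ×
    c2 p ≡ u1 * v1 + u0 * v2 ×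
    c1 p ≡ u1 * v0 + u0 * v1 ×
    c0 p ≡ u0 * v0

  linear-root : ∀ {u1} u0 → u1 ≢ 0ℚ → Σ ℚ λ t → u1 * t + u0 ≡ 0ℚ
  linear-root {u1} u0 u1≢0 = - u0 * 1/ u1 , (begin
    u1 * (- u0 * 1/ u1) + u0 ≡⟨ reassociate u1 u0 (1/ u1) ⟩
    - u0 * (u1 * 1/ u1) + u0 ≡⟨ cong (λ v → - u0 * v + u0) (*-inverseʳ u1) ⟩
    - u0 * 1ℚ + u0           ≡⟨ cancel u0 ⟩
    0ℚ                       ∎)
    where
    open ≡-Reasoning
    instance _ = ≢-nonZero u1≢0
    reassociate : ∀ u1 u0 w → u1 * (- u0 * w) + u0 ≡ - u0 * (u1 * w) + u0
    reassociate = solve-∀ ℚ-ring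
    cancel : ∀ u0 → - u0 * 1ℚ + u0 ≡ 0ℚ
    cancel = solve-∀ ℚ-ring

  root⇒reducible : ∀ p t → eval p t ≡ 0ℚ → Reducible p
  root⇒reducible (poly3 a b c d) t p[t]≡0 =
    1ℚ , - t , a , b + a * t , c + b * t + a * (t * t) , (λ ()) ,
    sym (*-identityˡ a) , divide₂ a b t , divide₁ a b c t ,
    trans (divide₀ a b c d t) (trans (cong (_+ - t * (c + b * t + a * (t * t))) p[t]≡0) (+-identityˡ _))
    where
    divide₂ : ∀ a b t → b ≡ 1ℚ * (b + a * t) + - t * a
    divide₂ = solve-∀ ℚ-ring
    divide₁ : ∀ a b c t → c ≡ 1ℚ * (c + b * t + a * (t * t)) + - t * (b + a * t)
    divide₁ = solve-∀ ℚ-ring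
    divide₀ : ∀ a b c d t →
      d ≡ (a * (t * t * t) + b * (t * t) + c * t + d) + - t * (c + b * t + a * (t * t))
    divide₀ = solve-∀ ℚ-ring

  reducible⇒root : ∀ p → Reducible p → Σ ℚ λ t → eval p t ≡ 0ℚ
  reducible⇒root (poly3 _ _ _ _) (u1 , u0 , v2 , v1 , v0 , u1≢0 , refl , refl , refl , refl) =
    t , trans (factorise u1 u0 v2 v1 v0 t) (trans (cong (_* q) (proj₂ (linear-root u0 u1≢0))) (*-zeroˡ q))
    where
    t q : ℚ
    t = proj₁ (linear-root u0 u1≢0)
    q = v2 * (t * t) + v1 * t + v0
    factorise : ∀ u1 u0 v2 v1 v0 t →
      u1 * v2 * (t * t * t) + (u1 * v1 + u0 * v2) * (t * t) + (u1 * v0 + u0 * v1) * t + u0 * v0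
        ≡ (u1 * t + u0) * (v2 * (t * t) + v1 * t + v0)
    factorise = solve-∀ ℚ-ring

  irreducible⇒rootless : ∀ {p} → Irreducible p → ∀ t → eval p t ≢ 0ℚ
  irreducible⇒rootless {p} irr t p[t]≡0 = irr (root⇒reducible p t p[t]≡0)

  eval-transform : ∀ L α β p t → eval (transform L α β p) t ≡ L * eval p (α * t + β)
  eval-transform L α β (poly3 a b c d) t = expand L α β a b c d t
    where
    expand : ∀ L α β a b c d t →
      L * (a * (α * α * α)) * (t * t * t)
        + L * ((1ℚ + 1ℚ + 1ℚ) * a * (α * α) * β + b * (α * α)) * (t * t)
        + L * ((1ℚ + 1ℚ + 1ℚ) * a * α * (β * β) + (1ℚ + 1ℚ) * b * α * β + c * α) * t
        + L * (a * (β * β * β) + b * (β * β) + c * β + d)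
      ≡ L * (a * ((α * t + β) * (α * t + β) * (α * t + β)) + b * ((α * t + β) * (α * t + β))
               + c * (α * t + β) + d)
    expand = solve-∀ ℚ-ring

  transform-cubic : ∀ {L α} β p → L ≢ 0ℚ → α ≢ 0ℚ → IsCubic p → IsCubic (transform L α β p)
  transform-cubic β p L≢0 α≢0 a≢0 = x#0y#0→xy#0 L≢0 (x#0y#0→xy#0 a≢0 (cube≢0 α≢0))

  transform-irreducible : ∀ {L} α β p → L ≢ 0ℚ → Irreducible p → Irreducible (transform L α β p)
  transform-irreducible {L} α β p L≢0 irr reducible =
    let t , root = reducible⇒root _ reducible
    in irreducible⇒rootless irr (α * t + β)
         (x*y≡0⇒y≡0 L≢0 (trans (sym (eval-transform L α β p t)) root))

  -- 27a²·p(−b/3a), a multiple of the value of p at its inflection point.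
  centralValue : Poly3 → ℚ
  centralValue (poly3 a b c d) = 27 * a * a * d - 9 * a * b * c + 2 * b * b * b

  centralValue-transform : ∀ L α β p →
    centralValue (transform L α β p) ≡ centralValue p * (L * (α * α * α) * (L * (α * α * α)) * L)
  centralValue-transform L α β (poly3 a b c d) = expand L α β a b c d
    where
    expand : ∀ L α β a b c d →
      27 * (L * (a * (α * α * α))) * (L * (a * (α * α * α)))
         * (L * (a * (β * β * β) + b * (β * β) + c * β + d))
      - 9 * (L * (a * (α * α * α)))
          * (L * ((1ℚ + 1ℚ + 1ℚ) * a * (α * α) * β + b * (α * α)))
          * (L * ((1ℚ + 1ℚ + 1ℚ) * a * α * (β * β) + (1ℚ + 1ℚ) * b * α * β + c * α))
      + 2 * (L * ((1ℚ + 1ℚ + 1ℚ) * a * (α * α) * β + b * (α * α)))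
          * (L * ((1ℚ + 1ℚ + 1ℚ) * a * (α * α) * β + b * (α * α)))
          * (L * ((1ℚ + 1ℚ + 1ℚ) * a * (α * α) * β + b * (α * α)))
      ≡ (27 * a * a * d - 9 * a * b * c + 2 * b * b * b) * (L * (α * α * α) * (L * (α * α * α)) * L)
    expand = solve-∀ ℚ-ring

  centralValue≢0 : ∀ {p} → IsCubic p → Irreducible p → centralValue p ≢ 0ℚ
  centralValue≢0 {p@(poly3 a b c d)} a≢0 irr centralValue≡0 =
    irreducible⇒rootless irr t (x*y≡0⇒y≡0 27a²≢0 (trans 27a²p[t]≡centralValue centralValue≡0))
    where
    open ≡-Reasoning
    3a≢0 : 3 * a ≢ 0ℚ
    3a≢0 = x#0y#0→xy#0 {3} (λ ()) a≢0
    27a²≢0 : 27 * a * a ≢ 0ℚ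
    27a²≢0 = x#0y#0→xy#0 (x#0y#0→xy#0 {27} (λ ()) a≢0) a≢0
    w t : ℚ
    w = (1/ (3 * a)) {{≢-nonZero 3a≢0}}
    t = - (b * w)
    substitute : ∀ a b c d w →
      27 * a * a * (a * (- (b * w) * - (b * w) * - (b * w)) + b * (- (b * w) * - (b * w)) + c * - (b * w) + d)
        ≡ 27 * a * a * d - 9 * a * b * c * (3 * a * w) + 3 * b * b * b * ((3 * a * w) * (3 * a * w))
            - b * b * b * ((3 * a * w) * (3 * a * w) * (3 * a * w))
    substitute = solve-∀ ℚ-ring
    at-1 : ∀ a b c d →
      27 * a * a * d - 9 * a * b * c * 1ℚ + 3 * b * b * b * (1ℚ * 1ℚ) - b * b * b * (1ℚ * 1ℚ * 1ℚ)
        ≡ 27 * a * a * d - 9 * a * b * c + 2 * b * b * b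
    at-1 = solve-∀ ℚ-ring
    27a²p[t]≡centralValue : 27 * a * a * eval p t ≡ centralValue p
    27a²p[t]≡centralValue = begin
      27 * a * a * eval p t
        ≡⟨ substitute a b c d w ⟩
      27 * a * a * d - 9 * a * b * c * (3 * a * w) + 3 * b * b * b * ((3 * a * w) * (3 * a * w))
        - b * b * b * ((3 * a * w) * (3 * a * w) * (3 * a * w))
        ≡⟨ cong (λ v → 27 * a * a * d - 9 * a * b * c * v + 3 * b * b * b * (v * v) - b * b * b * (v * v * v))
                (*-inverseʳ (3 * a) {{≢-nonZero 3a≢0}}) ⟩
      27 * a * a * d - 9 * a * b * c * 1ℚ + 3 * b * b * b * (1ℚ * 1ℚ) - b * b * b * (1ℚ * 1ℚ * 1ℚ)
        ≡⟨ at-1 a b c d ⟩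
      centralValue p ∎

  transform-injective-β : ∀ p {L α β β′} → IsCubic p → L ≢ 0ℚ → α ≢ 0ℚ →
    transform L α β p ≡ transform L α β′ p → β ≡ β′
  transform-injective-β (poly3 a b _ _) {α = α} a≢0 L≢0 α≢0 eq =
    *-cancelˡ-≢0 3aα²≢0 (∙-cancelʳ (b * (α * α)) _ _ (*-cancelˡ-≢0 L≢0 (cong c2 eq)))
    where
    3aα²≢0 : (1ℚ + 1ℚ + 1ℚ) * a * (α * α) ≢ 0ℚ
    3aα²≢0 = x#0y#0→xy#0 (x#0y#0→xy#0 {1ℚ + 1ℚ + 1ℚ} (λ ()) a≢0) (x#0y#0→xy#0 α≢0 α≢0)

  transform-injective : ∀ p {L α β L′ α′ β′} → IsCubic p → Irreducible p → L ≢ 0ℚ → α ≢ 0ℚ →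
    transform L α β p ≡ transform L′ α′ β′ p → (L , α , β) ≡ (L′ , α′ , β′)
  transform-injective p@(poly3 a _ _ _) {L} {α} {β} {L′} {α′} {β′} a≢0 irr L≢0 α≢0 eq =
    cong₂ _,_ L≡L′ (cong₂ _,_ α≡α′ β≡β′)
    where
    u u′ : ℚ
    u  = L * (α * α * α)
    u′ = L′ * (α′ * α′ * α′)
    u≡u′ : u ≡ u′
    u≡u′ = *-cancelˡ-≢0 a≢0 (trans (sym (x∙yz≈y∙xz L a _)) (trans (cong c3 eq) (x∙yz≈y∙xz L′ a _)))
    u²L≡u′²L′ : u * u * L ≡ u′ * u′ * L′
    u²L≡u′²L′ = *-cancelˡ-≢0 (centralValue≢0 a≢0 irr)
      (trans (sym (centralValue-transform L α β p))
        (trans (cong centralValue eq) (centralValue-transform L′ α′ β′ p)))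
    L≡L′ : L ≡ L′
    L≡L′ = *-cancelˡ-≢0 (x#0y#0→xy#0 u≢0 u≢0)
             (trans u²L≡u′²L′ (cong (λ v → v * v * L′) (sym u≡u′)))
      where u≢0 = x#0y#0→xy#0 L≢0 (cube≢0 α≢0)
    α≡α′ : α ≡ α′
    α≡α′ = cube-injective
             (*-cancelˡ-≢0 L≢0 (trans u≡u′ (cong (λ l → l * (α′ * α′ * α′)) (sym L≡L′))))
    β≡β′ : β ≡ β′
    β≡β′ = transform-injective-β p a≢0 L≢0 α≢0
      (subst₂ (λ l a → transform L α β p ≡ transform l a β′ p) (sym L≡L′) (sym α≡α′) eq)

  ℚ-field : ExtField
  ℚ-field = record
    { commRing   = +-*-commutativeRing
    ; nontrivial = λ ()
    ; inverse    = λ x x≢0 → (1/ x) {{≢-nonZero x≢0}} , *-inverseʳ x {{≢-nonZero x≢0}}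
    ; ι          = λ x → x
    ; ι-+        = λ _ _ → refl
    ; ι-*        = λ _ _ → refl
    ; ι-1        = refl
    }

  lowerCoeffs : Poly3 → Fin 3 → ℚ
  lowerCoeffs p zero             = c2 p
  lowerCoeffs p (suc zero)       = c1 p
  lowerCoeffs p (suc (suc zero)) = c0 p

  -- The lower coefficients of transform L α β p as polynomials with rational coefficients in the
  -- lower coefficients of p (var i0, i1, i2 standing for c2, c1, c0), so that the embedding ι of
  -- an extension field can be pushed through them.
  transformᴹ : (L α β a : ℚ) → Fin 3 → MPoly
  transformᴹ L α β a zero =
    con L ⊗ ((((con (1ℚ + 1ℚ + 1ℚ) ⊗ con a) ⊗ (con α ⊗ con α)) ⊗ con β) ⊕ (var i0 ⊗ (con α ⊗ con α)))
  transformᴹ L α β a (suc zero) =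
    con L ⊗ (((((con (1ℚ + 1ℚ + 1ℚ) ⊗ con a) ⊗ con α) ⊗ (con β ⊗ con β))
               ⊕ (((con (1ℚ + 1ℚ) ⊗ var i0) ⊗ con α) ⊗ con β))
             ⊕ (var i1 ⊗ con α))
  transformᴹ L α β a (suc (suc zero)) =
    con L ⊗ ((((con a ⊗ ((con β ⊗ con β) ⊗ con β)) ⊕ (var i0 ⊗ (con β ⊗ con β))) ⊕ (var i1 ⊗ con β))
             ⊕ var i2)

  lowerCoeffs-transform : ∀ L α β p i →
    lowerCoeffs (transform L α β p) i ≡ evalM ℚ-field (lowerCoeffs p) (transformᴹ L α β (c3 p) i)
  lowerCoeffs-transform L α β p zero             = refl
  lowerCoeffs-transform L α β p (suc zero)       = refl
  lowerCoeffs-transform L α β p (suc (suc zero)) = refl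

  affineᴹ : ℚ → ℚ → MPoly → MPoly
  affineᴹ u v (con a) = con a
  affineᴹ u v (var i) = (var i ⊗ con u) ⊕ con v
  affineᴹ u v (F ⊕ G) = affineᴹ u v F ⊕ affineᴹ u v G
  affineᴹ u v (F ⊗ G) = affineᴹ u v F ⊗ affineᴹ u v G

  -- y ↦ (q(αy + β) − β)/α
  conjugate : ∀ {α} (β : ℚ) → α ≢ 0ℚ → Poly2 → Poly2
  conjugate {α} β α≢0 q = poly2
    (b2 q * α)
    ((1ℚ + 1ℚ) * b2 q * β + b1 q)
    ((evalQ ℚ-field q β - β) * (1/ α) {{≢-nonZero α≢0}})

  conjugate-quadratic : ∀ {α} β q (α≢0 : α ≢ 0ℚ) → IsQuadratic q → IsQuadratic (conjugate β α≢0 q)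
  conjugate-quadratic β q α≢0 b2≢0 = x#0y#0→xy#0 b2≢0 α≢0

open RationalCubics

module InExtension (K : ExtField) where

  open ExtField K hiding (zero)
  open import Data.Fin using (Fin; zero; suc)
  open import Data.Fin.Permutation using (_⟨$⟩ʳ_)
  open import Data.Maybe using (map)
  open import Data.Product using (_,_; proj₁; proj₂)
  open import Data.Rational using (1ℚ; 1/_; ≢-nonZero)
    renaming (_+_ to _+ℚ_; _*_ to _*ℚ_; -_ to -ℚ_; _-_ to _-ℚ_)
  open import Data.Rational.Properties using (+-*-rawRing; _≟_)
  import Data.Rational.Properties as ℚ
  open import Relation.Binary.PropositionalEquality as ≡ using (_≡_; _≢_)
  open import Relation.Nullary.Decidable using (dec⇒maybe)
  open import Relation.Binary.Reasoning.Setoid setoid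
  open import Algebra.Properties.Group +-group using (identityʳ-unique; inverseʳ-unique)
  open import Algebra.Solver.Ring.AlmostCommutativeRing
    using (fromCommutativeRing; _-Raw-AlmostCommutative⟶_)
  open import Tactic.RingSolver using (solve-∀)

  ι-0 : ι 0ℚ ≈ 0#
  ι-0 = identityʳ-unique (ι 0ℚ) (ι 0ℚ) (sym (ι-+ 0ℚ 0ℚ))

  ι-neg : ∀ x → ι (-ℚ x) ≈ - ι x
  ι-neg x = inverseʳ-unique (ι x) (ι (-ℚ x))
    (trans (sym (ι-+ x (-ℚ x))) (trans (reflexive (≡.cong ι (ℚ.+-inverseʳ x))) ι-0))

  ι-morphism : +-*-rawRing -Raw-AlmostCommutative⟶ fromCommutativeRing commRing
  ι-morphism = record
    { ⟦_⟧ = ι ; +-homo = ι-+ ; *-homo = ι-* ; -‿homo = ι-neg ; 0-homo = ι-0 ; 1-homo = ι-1 }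

  open import Algebra.Solver.Ring +-*-rawRing (fromCommutativeRing commRing) ι-morphism
    (λ x y → map (λ x≡y → reflexive (≡.cong ι x≡y)) (dec⇒maybe (x ≟ y)))
    using (solve; _:=_; _:+_; _:*_; :-_) renaming (con to κ)

  ι-evalM : ∀ z F → ι (evalM ℚ-field z F) ≈ evalM K (λ i → ι (z i)) F
  ι-evalM z (con a) = refl
  ι-evalM z (var i) = refl
  ι-evalM z (F ⊕ G) = trans (ι-+ _ _) (+-cong (ι-evalM z F) (ι-evalM z G))
  ι-evalM z (F ⊗ G) = trans (ι-* _ _) (*-cong (ι-evalM z F) (ι-evalM z G))

  ι-evalQ : ∀ q t → ι (evalQ ℚ-field q t) ≈ evalQ K q (ι t)
  ι-evalQ q t =
    trans (ι-+ _ _) (+-cong (trans (ι-+ _ _) (+-cong (trans (ι-* _ _) (*-cong refl (ι-* t t))) (ι-* _ _))) refl)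

  evalM-cong : ∀ F {z z′} → (∀ i → z i ≈ z′ i) → evalM K z F ≈ evalM K z′ F
  evalM-cong (con a) z≈z′ = refl
  evalM-cong (var i) z≈z′ = z≈z′ i
  evalM-cong (F ⊕ G) z≈z′ = +-cong (evalM-cong F z≈z′) (evalM-cong G z≈z′)
  evalM-cong (F ⊗ G) z≈z′ = *-cong (evalM-cong F z≈z′) (evalM-cong G z≈z′)

  evalQ-cong : ∀ q {x y} → x ≈ y → evalQ K q x ≈ evalQ K q y
  evalQ-cong q x≈y = +-cong (+-cong (*-cong refl (*-cong x≈y x≈y)) (*-cong refl x≈y)) refl

  affine : ℚ → ℚ → Carrier → Carrier
  affine u v x = x * ι u + ι v

  affine-cong : ∀ u v {x y} → x ≈ y → affine u v x ≈ affine u v y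
  affine-cong u v x≈y = +-cong (*-cong x≈y refl) refl

  affine-∘ : ∀ u v u′ v′ x → affine u v (affine u′ v′ x) ≈ affine (u′ *ℚ u) (v′ *ℚ u +ℚ v) x
  affine-∘ u v u′ v′ x = begin
    (x * ι u′ + ι v′) * ι u + ι v
      ≈⟨ solve 5 (λ x U U′ V V′ → (x :* U′ :+ V′) :* U :+ V := x :* (U′ :* U) :+ (V′ :* U :+ V))
               refl x (ι u) (ι u′) (ι v) (ι v′) ⟩
    x * (ι u′ * ι u) + (ι v′ * ι u + ι v)
      ≈⟨ sym (+-cong (*-cong refl (ι-* u′ u)) (trans (ι-+ _ _) (+-cong (ι-* v′ u) refl))) ⟩
    x * ι (u′ *ℚ u) + ι (v′ *ℚ u +ℚ v) ∎

  affine-identity : ∀ x → affine 1ℚ 0ℚ x ≈ x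
  affine-identity x = trans (+-cong (*-cong refl ι-1) ι-0) (trans (+-identityʳ _) (*-identityʳ x))

  evalM-affineᴹ : ∀ u v z F → evalM K z (affineᴹ u v F) ≡ evalM K (λ i → affine u v (z i)) F
  evalM-affineᴹ u v z (con a) = ≡.refl
  evalM-affineᴹ u v z (var i) = ≡.refl
  evalM-affineᴹ u v z (F ⊕ G) = ≡.cong₂ _+_ (evalM-affineᴹ u v z F) (evalM-affineᴹ u v z G)
  evalM-affineᴹ u v z (F ⊗ G) = ≡.cong₂ _*_ (evalM-affineᴹ u v z F) (evalM-affineᴹ u v z G)

  InGal-cong : ∀ {x x′ σ} → (∀ i → x i ≈ x′ i) → InGal K x σ → InGal K x′ σ
  InGal-cong {σ = σ} x≈x′ x-gal F F[x′]≈0 =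
    trans (evalM-cong F (λ i → sym (x≈x′ (σ ⟨$⟩ʳ i)))) (x-gal F (trans (evalM-cong F x≈x′) F[x′]≈0))

  InGal-affine : ∀ u v {x σ} → InGal K x σ → InGal K (λ i → affine u v (x i)) σ
  InGal-affine u v {x} {σ} x-gal F F[ux+v]≈0 = begin
    evalM K (λ i → affine u v (x (σ ⟨$⟩ʳ i))) F
      ≈⟨ reflexive (≡.sym (evalM-affineᴹ u v (λ i → x (σ ⟨$⟩ʳ i)) F)) ⟩
    evalM K (λ i → x (σ ⟨$⟩ʳ i)) (affineᴹ u v F)
      ≈⟨ x-gal (affineᴹ u v F) (trans (reflexive (evalM-affineᴹ u v x F)) F[ux+v]≈0) ⟩
    0# ∎

  vieta : Carrier → (Fin 3 → Carrier) → Fin 3 → Carrier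
  vieta a x zero             = - (a * (x i0 + x i1 + x i2))
  vieta a x (suc zero)       = a * (x i0 * x i1 + x i0 * x i2 + x i1 * x i2)
  vieta a x (suc (suc zero)) = - (a * (x i0 * x i1 * x i2))

  RootsIn⇒vieta : ∀ {p x} → RootsIn K p x → ∀ i → ι (lowerCoeffs p i) ≈ vieta (ι (c3 p)) x i
  RootsIn⇒vieta (r₂ , r₁ , r₀) zero             = r₂
  RootsIn⇒vieta (r₂ , r₁ , r₀) (suc zero)       = r₁
  RootsIn⇒vieta (r₂ , r₁ , r₀) (suc (suc zero)) = r₀

  vieta⇒RootsIn : ∀ {p x} → (∀ i → ι (lowerCoeffs p i) ≈ vieta (ι (c3 p)) x i) → RootsIn K p x
  vieta⇒RootsIn r = r zero , r (suc zero) , r (suc (suc zero))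

  vieta-cong : ∀ {a a′ x x′} → a ≈ a′ → (∀ i → x i ≈ x′ i) → ∀ i → vieta a x i ≈ vieta a′ x′ i
  vieta-cong a≈a′ x≈x′ zero =
    -‿cong (*-cong a≈a′ (+-cong (+-cong (x≈x′ i0) (x≈x′ i1)) (x≈x′ i2)))
  vieta-cong a≈a′ x≈x′ (suc zero) =
    *-cong a≈a′ (+-cong (+-cong (*-cong (x≈x′ i0) (x≈x′ i1)) (*-cong (x≈x′ i0) (x≈x′ i2)))
                        (*-cong (x≈x′ i1) (x≈x′ i2)))
  vieta-cong a≈a′ x≈x′ (suc (suc zero)) =
    -‿cong (*-cong a≈a′ (*-cong (*-cong (x≈x′ i0) (x≈x′ i1)) (x≈x′ i2)))

  RootsIn-cong : ∀ {p x x′} → (∀ i → x i ≈ x′ i) → RootsIn K p x → RootsIn K p x′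
  RootsIn-cong x≈x′ roots = vieta⇒RootsIn (λ i → trans (RootsIn⇒vieta roots i) (vieta-cong refl x≈x′ i))

  ι-leading : ∀ L α β p → ι (c3 (transform L α β p)) ≈ ι L * (ι (c3 p) * (ι α * ι α * ι α))
  ι-leading L α β p =
    trans (ι-* _ _) (*-cong refl (trans (ι-* _ _) (*-cong refl (trans (ι-* _ _) (*-cong (ι-* α α) refl)))))

  vieta-transformᴹ : ∀ L α β a y i →
    evalM K (vieta (ι a) (λ j → affine α β (y j))) (transformᴹ L α β a i)
      ≈ vieta (ι L * (ι a * (ι α * ι α * ι α))) y i
  vieta-transformᴹ L α β a y zero = solve 7
    (λ Λ A e B y₀ y₁ y₂ →
      Λ :* (κ (1ℚ +ℚ 1ℚ +ℚ 1ℚ) :* A :* (e :* e) :* B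
            :+ :- (A :* (y₀ :* e :+ B :+ (y₁ :* e :+ B) :+ (y₂ :* e :+ B))) :* (e :* e))
      := :- (Λ :* (A :* (e :* e :* e)) :* (y₀ :+ y₁ :+ y₂)))
    refl (ι L) (ι a) (ι α) (ι β) (y i0) (y i1) (y i2)
  vieta-transformᴹ L α β a y (suc zero) = solve 7
    (λ Λ A e B y₀ y₁ y₂ →
      Λ :* (κ (1ℚ +ℚ 1ℚ +ℚ 1ℚ) :* A :* e :* (B :* B)
            :+ κ (1ℚ +ℚ 1ℚ) :* :- (A :* (y₀ :* e :+ B :+ (y₁ :* e :+ B) :+ (y₂ :* e :+ B))) :* e :* B
            :+ A :* ((y₀ :* e :+ B) :* (y₁ :* e :+ B) :+ (y₀ :* e :+ B) :* (y₂ :* e :+ B)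
                     :+ (y₁ :* e :+ B) :* (y₂ :* e :+ B)) :* e)
      := Λ :* (A :* (e :* e :* e)) :* (y₀ :* y₁ :+ y₀ :* y₂ :+ y₁ :* y₂))
    refl (ι L) (ι a) (ι α) (ι β) (y i0) (y i1) (y i2)
  vieta-transformᴹ L α β a y (suc (suc zero)) = solve 7
    (λ Λ A e B y₀ y₁ y₂ →
      Λ :* (A :* (B :* B :* B)
            :+ :- (A :* (y₀ :* e :+ B :+ (y₁ :* e :+ B) :+ (y₂ :* e :+ B))) :* (B :* B)
            :+ A :* ((y₀ :* e :+ B) :* (y₁ :* e :+ B) :+ (y₀ :* e :+ B) :* (y₂ :* e :+ B)
                     :+ (y₁ :* e :+ B) :* (y₂ :* e :+ B)) :* B
            :+ :- (A :* ((y₀ :* e :+ B) :* (y₁ :* e :+ B) :* (y₂ :* e :+ B))))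
      := :- (Λ :* (A :* (e :* e :* e)) :* (y₀ :* y₁ :* y₂)))
    refl (ι L) (ι a) (ι α) (ι β) (y i0) (y i1) (y i2)

  RootsIn-transform : ∀ L α β p y →
    RootsIn K p (λ i → affine α β (y i)) → RootsIn K (transform L α β p) y
  RootsIn-transform L α β p y roots = vieta⇒RootsIn λ i → begin
    ι (lowerCoeffs (transform L α β p) i)
      ≈⟨ reflexive (≡.cong ι (lowerCoeffs-transform L α β p i)) ⟩
    ι (evalM ℚ-field (lowerCoeffs p) (transformᴹ L α β (c3 p) i))
      ≈⟨ ι-evalM (lowerCoeffs p) (transformᴹ L α β (c3 p) i) ⟩
    evalM K (λ j → ι (lowerCoeffs p j)) (transformᴹ L α β (c3 p) i)
      ≈⟨ evalM-cong (transformᴹ L α β (c3 p) i) (RootsIn⇒vieta roots) ⟩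
    evalM K (vieta (ι (c3 p)) (λ j → affine α β (y j))) (transformᴹ L α β (c3 p) i)
      ≈⟨ vieta-transformᴹ L α β (c3 p) y i ⟩
    vieta (ι L * (ι (c3 p) * (ι α * ι α * ι α))) y i
      ≈⟨ vieta-cong (sym (ι-leading L α β p)) (λ _ → refl) i ⟩
    vieta (ι (c3 (transform L α β p))) y i ∎

  GaloisGroupIsA3 : (Fin 3 → Carrier) → Set
  GaloisGroupIsA3 x = ∀ σ → (InGal K x σ → InA3 σ) × (InA3 σ → InGal K x σ)

  module Shift {α} (β : ℚ) (α≢0 : α ≢ 0ℚ) where

    α⁻¹ β′ : ℚ
    α⁻¹ = (1/ α) {{≢-nonZero α≢0}}
    β′  = -ℚ (β *ℚ α⁻¹)

    shift : Carrier → Carrier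
    shift = affine α⁻¹ β′

    affine-shift : ∀ x → affine α β (shift x) ≈ x
    affine-shift x = begin
      affine α β (shift x)               ≈⟨ affine-∘ α β α⁻¹ β′ x ⟩
      affine (α⁻¹ *ℚ α) (β′ *ℚ α +ℚ β) x ≡⟨ ≡.cong₂ (λ u v → affine u v x) α⁻¹α≡1 β′α+β≡0 ⟩
      affine 1ℚ 0ℚ x                     ≈⟨ affine-identity x ⟩
      x                                  ∎
      where
      α⁻¹α≡1 : α⁻¹ *ℚ α ≡ 1ℚ
      α⁻¹α≡1 = ℚ.*-inverseˡ α {{≢-nonZero α≢0}}
      regroup : ∀ β w α → -ℚ (β *ℚ w) *ℚ α +ℚ β ≡ β *ℚ (1ℚ -ℚ w *ℚ α)
      regroup = solve-∀ ℚ-ring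
      β′α+β≡0 : β′ *ℚ α +ℚ β ≡ 0ℚ
      β′α+β≡0 = ≡.trans (regroup β α⁻¹ α)
                  (≡.trans (≡.cong (λ t → β *ℚ (1ℚ -ℚ t)) α⁻¹α≡1) (ℚ.*-zeroʳ β))

    shift-affine : ∀ y → shift (affine α β y) ≈ y
    shift-affine y = begin
      shift (affine α β y)                 ≈⟨ affine-∘ α⁻¹ β′ α β y ⟩
      affine (α *ℚ α⁻¹) (β *ℚ α⁻¹ +ℚ β′) y ≡⟨ ≡.cong₂ (λ u v → affine u v y)
                                                 (ℚ.*-inverseʳ α {{≢-nonZero α≢0}}) (ℚ.+-inverseʳ (β *ℚ α⁻¹)) ⟩
      affine 1ℚ 0ℚ y                       ≈⟨ affine-identity y ⟩
      y                                    ∎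

    affine-conjugate : ∀ q Y → affine α β (evalQ K (conjugate β α≢0 q) Y) ≈ evalQ K q (affine α β Y)
    affine-conjugate q Y = begin
      (G₂ * (Y * Y) + G₁ * Y + G₀) * ι α + ι β
        ≈⟨ solve 6 (λ G₂ G₁ G₀ Y e B →
                     (G₂ :* (Y :* Y) :+ G₁ :* Y :+ G₀) :* e :+ B
                     := (G₂ :* (Y :* Y) :+ G₁ :* Y) :* e :+ (G₀ :* e :+ B))
                   refl G₂ G₁ G₀ Y (ι α) (ι β) ⟩
      (G₂ * (Y * Y) + G₁ * Y) * ι α + (G₀ * ι α + ι β)
        ≈⟨ +-cong (*-cong (+-cong (*-cong (ι-* (b2 q) α) refl) (*-cong ι-G₁ refl)) refl)
                  (+-cong G₀α≈q[β]-β refl) ⟩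
      (ι (b2 q) * ι α * (Y * Y) + (ι (1ℚ +ℚ 1ℚ) * ι (b2 q) * ι β + ι (b1 q)) * Y) * ι α
        + (evalQ K q (ι β) + - ι β + ι β)
        ≈⟨ solve 6 (λ b₂ b₁ b₀ Y e B →
                     (b₂ :* e :* (Y :* Y) :+ (κ (1ℚ +ℚ 1ℚ) :* b₂ :* B :+ b₁) :* Y) :* e
                       :+ (b₂ :* (B :* B) :+ b₁ :* B :+ b₀ :+ :- B :+ B)
                     := b₂ :* ((Y :* e :+ B) :* (Y :* e :+ B)) :+ b₁ :* (Y :* e :+ B) :+ b₀)
                   refl (ι (b2 q)) (ι (b1 q)) (ι (b0 q)) Y (ι α) (ι β) ⟩
      evalQ K q (affine α β Y) ∎
      where
      q[β]-β : ℚ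
      q[β]-β = evalQ ℚ-field q β -ℚ β
      G₂ G₁ G₀ : Carrier
      G₂ = ι (b2 q *ℚ α)
      G₁ = ι ((1ℚ +ℚ 1ℚ) *ℚ b2 q *ℚ β +ℚ b1 q)
      G₀ = ι (q[β]-β *ℚ α⁻¹)
      ι-G₁ : G₁ ≈ ι (1ℚ +ℚ 1ℚ) * ι (b2 q) * ι β + ι (b1 q)
      ι-G₁ = trans (ι-+ _ _) (+-cong (trans (ι-* _ _) (*-cong (ι-* _ _) refl)) refl)
      G₀α≈q[β]-β : G₀ * ι α ≈ evalQ K q (ι β) + - ι β
      G₀α≈q[β]-β = begin
        ι (q[β]-β *ℚ α⁻¹) * ι α          ≈⟨ sym (ι-* _ _) ⟩
        ι (q[β]-β *ℚ α⁻¹ *ℚ α)           ≡⟨ ≡.cong ι (≡.trans (ℚ.*-assoc q[β]-β α⁻¹ α)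
                                              (≡.trans (≡.cong (q[β]-β *ℚ_) (ℚ.*-inverseˡ α {{≢-nonZero α≢0}}))
                                                (ℚ.*-identityʳ q[β]-β))) ⟩
        ι q[β]-β                         ≈⟨ ι-+ _ _ ⟩
        ι (evalQ ℚ-field q β) + ι (-ℚ β) ≈⟨ +-cong (ι-evalQ q β) (ι-neg β) ⟩
        evalQ K q (ι β) + - ι β          ∎

    shift-conjugate : ∀ q {x x′} → evalQ K q x ≈ x′ → evalQ K (conjugate β α≢0 q) (shift x) ≈ shift x′
    shift-conjugate q {x} {x′} q[x]≈x′ = begin
      evalQ K (conjugate β α≢0 q) (shift x)
        ≈⟨ sym (shift-affine _) ⟩
      shift (affine α β (evalQ K (conjugate β α≢0 q) (shift x)))
        ≈⟨ affine-cong α⁻¹ β′ (affine-conjugate q (shift x)) ⟩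
      shift (evalQ K q (affine α β (shift x)))
        ≈⟨ affine-cong α⁻¹ β′ (evalQ-cong q (affine-shift x)) ⟩
      shift (evalQ K q x)
        ≈⟨ affine-cong α⁻¹ β′ q[x]≈x′ ⟩
      shift x′ ∎

    RootsIn-shift : ∀ L {p} x → RootsIn K p x → RootsIn K (transform L α β p) (λ i → shift (x i))
    RootsIn-shift L {p} x roots =
      RootsIn-transform L α β p (λ i → shift (x i)) (RootsIn-cong (λ i → sym (affine-shift (x i))) roots)

    galois-shift : ∀ {x} → GaloisGroupIsA3 x → GaloisGroupIsA3 (λ i → shift (x i))
    galois-shift {x} galois σ =
      (λ y-gal → proj₁ (galois σ)
                   (InGal-cong {σ = σ} (λ i → affine-shift (x i)) (InGal-affine α β {y} {σ} y-gal))) ,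
      (λ σ∈A₃ → InGal-affine α⁻¹ β′ {x} {σ} (proj₂ (galois σ) σ∈A₃))
      where
      y : Fin 3 → Carrier
      y i = shift (x i)

open import Data.Product using (_,_)
open import Relation.Binary.PropositionalEquality using (_≢_; refl; cong)

cubicGalois-transform : ∀ {L α} β p → L ≢ 0ℚ → α ≢ 0ℚ → CubicGalois p → CubicGalois (transform L α β p)
cubicGalois-transform {L} {α} β p L≢0 α≢0 (cubic , irreducible , K , x , roots , galois) =
  transform-cubic β p L≢0 α≢0 cubic , transform-irreducible α β p L≢0 irreducible ,
  K , (λ i → shift (x i)) , RootsIn-shift L x roots , galois-shift galois
  where open InExtension.Shift K β α≢0

cyclPerm-transform : ∀ {α} L β p q (α≢0 : α ≢ 0ℚ) →
  CyclPerm q p → CyclPerm (conjugate β α≢0 q) (transform L α β p)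
cyclPerm-transform L β p q α≢0 (K , x , roots , x₀↦x₁ , x₁↦x₂ , x₂↦x₀) =
  K , (λ i → shift (x i)) , RootsIn-shift L x roots ,
  shift-conjugate q x₀↦x₁ , shift-conjugate q x₁↦x₂ , shift-conjugate q x₂↦x₀
  where open InExtension.Shift K β α≢0

coupled-transform : ∀ {L α} β p r → L ≢ 0ℚ → α ≢ 0ℚ →
  Coupled p r → Coupled (transform L α β p) (transform L α β r)
coupled-transform {L} β p r L≢0 α≢0 (p-galois , r-galois , q , quadratic , q-cycles-p , q-cycles-r) =
  cubicGalois-transform β p L≢0 α≢0 p-galois , cubicGalois-transform β r L≢0 α≢0 r-galois ,
  conjugate β α≢0 q , conjugate-quadratic β q α≢0 quadratic ,
  cyclPerm-transform L β p q α≢0 q-cycles-p , cyclPerm-transform L β r q α≢0 q-cycles-r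

transform-transfer : ∀ p r L α β L′ α′ β′ → CubicGalois p → L ≢ 0ℚ → α ≢ 0ℚ →
  transform L α β p ≡ transform L′ α′ β′ p → transform L α β r ≡ transform L′ α′ β′ r
transform-transfer p r L α β L′ α′ β′ (cubic , irreducible , _) L≢0 α≢0 eq =
  cong (λ { (L , α , β) → transform L α β r })
       (transform-injective p {L} {α} {β} {L′} {α′} {β′} cubic irreducible L≢0 α≢0 eq)

mainTheorem5 : (p r : Poly3) → Coupled p r →
    -- the map λ p(αx+β) ↦ λ r(αx+β) is well defined on C(p)
    ((l α β l′ α′ β′ : ℚ) → ¬ (l ≡ 0ℚ) → ¬ (α ≡ 0ℚ) → ¬ (l′ ≡ 0ℚ) → ¬ (α′ ≡ 0ℚ) →
      transform l α β p ≡ transform l′ α′ β′ p →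
      transform l α β r ≡ transform l′ α′ β′ r) ×
    -- it is injective
    ((l α β l′ α′ β′ : ℚ) → ¬ (l ≡ 0ℚ) → ¬ (α ≡ 0ℚ) → ¬ (l′ ≡ 0ℚ) → ¬ (α′ ≡ 0ℚ) →
      transform l α β r ≡ transform l′ α′ β′ r →
      transform l α β p ≡ transform l′ α′ β′ p) ×
    -- it is surjective onto C(r)
    ((l α β : ℚ) → ¬ (l ≡ 0ℚ) → ¬ (α ≡ 0ℚ) →
      Σ ℚ λ l′ → Σ ℚ λ α′ → Σ ℚ λ β′ → ¬ (l′ ≡ 0ℚ) × ¬ (α′ ≡ 0ℚ) ×
        transform l′ α′ β′ r ≡ transform l α β r) ×
    -- it sends each polynomial of C(p) to one coupled with it
    ((l α β : ℚ) → ¬ (l ≡ 0ℚ) → ¬ (α ≡ 0ℚ) →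
      Coupled (transform l α β p) (transform l α β r))
mainTheorem5 p r coupled@(p-galois , r-galois , _) =
  (λ l α β l′ α′ β′ l≢0 α≢0 _ _ → transform-transfer p r l α β l′ α′ β′ p-galois l≢0 α≢0) ,
  (λ l α β l′ α′ β′ l≢0 α≢0 _ _ → transform-transfer r p l α β l′ α′ β′ r-galois l≢0 α≢0) ,
  (λ l α β l≢0 α≢0 → l , α , β , l≢0 , α≢0 , refl) ,
  (λ _ _ β l≢0 α≢0 → coupled-transform β p r l≢0 α≢0 coupled)
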